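{- Let $k\geq 4$ and let $M$ be a graphic matroid with no coloop and no $2$-cocircuit. Suppose $M_T/T'\cong F$ for some $T\subseteq E(M)$ with $|T|=k$, some $T'\subseteq T$, and some $F\in\{F_7,F_7^*,M^*(K_5),M^*(K_{3,3})\}$. Then there is a binary matroid $N$ containing an element $a$ such that $N\backslash a\cong F$. Further, $N/a$ is a minor of $M$, and either $M=N/a$ or $M$ is a coextension of $N/a$ by at most $k$ elements.
   Context: Splitting matroid: for a binary matroid $M$ with a standard matrix representation $A$ over $GF(2)$ and $T\subseteq E(M)$, let $A_T$ be obtained from $A$ by adjoining one extra row whose entries are $1$ in the columns labelled by elements of $T$ and $0$ otherwise; $M_T$ is the vector matroid of $A_T$. $M$ is a coextension of a matroid $P$ by $h$ elements if there is $X\subseteq E(M)$ with $|X|=h$ such that $M/X\cong P$. -}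

module Defs where

open import Data.Nat using (ℕ; zero; suc; _≤_)
open import Data.Nat.DivMod using (_%_; m%n<n)
open import Data.Bool using (Bool; true; false; _∧_; _xor_; if_then_else_)
open import Data.Fin using (Fin; zero; suc; toℕ; fromℕ<)
open import Data.Fin.Subset using (Subset; _∈_; _∉_; _⊆_; _⊂_; _∩_; _∪_; _─_; ⊤; ⁅_⁆; ∣_∣; Empty; Nonempty)
open import Data.Vec using (Vec; lookup; tabulate; _∷_; [])
open import Data.Fin.Patterns using (0F; 1F; 2F; 3F; 4F; 5F)
open import Data.Product using (Σ; ∃; ∃-syntax; _×_; _,_)
open import Data.Sum using (_⊎_)
open import Relation.Nullary using (¬_)
open import Relation.Binary.PropositionalEquality using (_≡_; _≢_)
open import Function.Bundles using (_⇔_)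
open import Function.Definitions using (Injective)

-- A "matroid" here is a ground set E ⊆ Fin n together with a predicate
-- Ind on subsets; the independent sets are the X ⊆ E with Ind X.
-- All matroids occurring below are built from graphs / GF(2)-matrices
-- and operations (minors, duals) of those, so matroid axioms are not
-- imposed separately.

record Matroid : Set₁ where
  field
    size : ℕ
    E    : Subset size
    Ind  : Subset size → Set
open Matroid public

Indep : (M : Matroid) → Subset (size M) → Set
Indep M X = X ⊆ E M × Ind M X

IsBasisOf : (M : Matroid) → Subset (size M) → Subset (size M) → Set
IsBasisOf M S B =
  B ⊆ S × Indep M B ×
  (∀ B' → B ⊆ B' → B' ⊆ S → Indep M B' → B' ⊆ B)

Basis : (M : Matroid) → Subset (size M) → Set
Basis M B = IsBasisOf M (E M) B

Circuit : (M : Matroid) → Subset (size M) → Set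
Circuit M C = C ⊆ E M × ¬ Indep M C × (∀ D → D ⊂ C → Indep M D)

dual : Matroid → Matroid
dual M = record { size = size M ; E = E M
                ; Ind = λ I → ∃[ B ] (Basis M B × Empty (B ∩ I)) }

Cocircuit : (M : Matroid) → Subset (size M) → Set
Cocircuit M C = Circuit (dual M) C

Coloop : (M : Matroid) → Fin (size M) → Set
Coloop M e = e ∈ E M × (∀ B → Basis M B → e ∈ B)

delete : (M : Matroid) → Subset (size M) → Matroid
delete M Y = record { size = size M ; E = E M ─ Y ; Ind = Ind M }

contract : (M : Matroid) → Subset (size M) → Matroid
contract M X = record
  { size = size M ; E = E M ─ X
  ; Ind = λ I → Empty (I ∩ X) ×
                ∃[ B ] (IsBasisOf M (X ∩ E M) B × Indep M (I ∪ B)) }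

infixl 8 _＼_ _／_
infix 4 _≅_
_＼_ : (M : Matroid) → Fin (size M) → Matroid
M ＼ a = delete M ⁅ a ⁆

_／_ : (M : Matroid) → Fin (size M) → Matroid
M ／ a = contract M ⁅ a ⁆

record _≅_ (M N : Matroid) : Set where
  field
    f   : Fin (size M) → Fin (size N)
    g   : Fin (size N) → Fin (size M)
    f∈  : ∀ {i} → i ∈ E M → f i ∈ E N
    g∈  : ∀ {j} → j ∈ E N → g j ∈ E M
    gf  : ∀ {i} → i ∈ E M → g (f i) ≡ i
    fg  : ∀ {j} → j ∈ E N → f (g j) ≡ j
    ind : ∀ X Y → X ⊆ E M → Y ⊆ E N →
          (∀ i → i ∈ E M → (i ∈ X ⇔ f i ∈ Y)) →
          (Indep M X ⇔ Indep N Y)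

IsMinor : Matroid → Matroid → Set
IsMinor P M = ∃[ X ] ∃[ Y ] (X ⊆ E M × Y ⊆ E M × Empty (X ∩ Y) ×
                             delete (contract M X) Y ≅ P)

CoextensionBy : Matroid → Matroid → ℕ → Set
CoextensionBy M P h = ∃[ X ] (X ⊆ E M × ∣ X ∣ ≡ h × contract M X ≅ P)

-- Binary matroids: vector matroids of GF(2) matrices (GF(2) = Bool,
-- addition = xor).

Matrix : ℕ → ℕ → Set
Matrix r n = Fin r → Fin n → Bool

xorSum : ∀ {n} → (Fin n → Bool) → Bool
xorSum {zero} f = false
xorSum {suc n} f = f zero xor xorSum (λ i → f (suc i))

colSum : ∀ {r n} → Matrix r n → Subset n → Fin r → Bool
colSum A Y i = xorSum (λ j → lookup Y j ∧ A i j)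

LinIndep : ∀ {r n} → Matrix r n → Subset n → Set
LinIndep A X = ∀ Y → Y ⊆ X → Nonempty Y → ¬ (∀ i → colSum A Y i ≡ false)

vecMatroid : ∀ {r n} → Matrix r n → Matroid
vecMatroid {r} {n} A = record { size = n ; E = ⊤ ; Ind = LinIndep A }

addRow : ∀ {r n} → Matrix r n → Subset n → Matrix (suc r) n
addRow A T zero    j = lookup T j
addRow A T (suc i) j = A i j

splitting : ∀ {r n} → Matrix r n → Subset n → Matroid
splitting A T = vecMatroid (addRow A T)

-- Graphs and graphic matroids. A (multi)graph with v vertices and n
-- edges is given by the ends of each edge (loops allowed).

Graph : ℕ → ℕ → Set
Graph v n = Fin n → Fin v × Fin v

Joins : ∀ {v n} → Graph v n → Fin n → Fin v → Fin v → Set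
Joins G e x y = G e ≡ (x , y) ⊎ G e ≡ (y , x)

next : ∀ {k} → Fin (suc k) → Fin (suc k)
next {k} i = fromℕ< (m%n<n (suc (toℕ i)) (suc k))

HasCycle : ∀ {v n} → Graph v n → Subset n → Set
HasCycle {v} {n} G X =
  Σ ℕ λ k → Σ (Fin (suc k) → Fin n) λ e → Σ (Fin (suc k) → Fin v) λ w →
    (Injective _≡_ _≡_ e × Injective _≡_ _≡_ w ×
     (∀ (i : Fin (suc k)) → e i ∈ X × Joins G (e i) (w i) (w (next i))))

cycleMatroid : ∀ {v n} → Graph v n → Matroid
cycleMatroid {v} {n} G = record { size = n ; E = ⊤ ; Ind = λ X → ¬ HasCycle G X }

IsGraphic : Matroid → Set
IsGraphic M = ∃[ v ] ∃[ G ] (M ≅ cycleMatroid {v} {size M} G)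

-- F₇: columns are the 7 nonzero vectors of GF(2)^3
F7mat : Matrix 3 7
F7mat i j = bit i (suc (toℕ j))
  where
  odd : ℕ → Bool
  odd zero = false
  odd (suc zero) = true
  odd (suc (suc m)) = odd m
  half : ℕ → ℕ
  half zero = zero
  half (suc zero) = zero
  half (suc (suc m)) = suc (half m)
  bit : ∀ {r} → Fin r → ℕ → Bool
  bit zero m = odd m
  bit (suc i) m = bit i (half m)

F₇ : Matroid
F₇ = vecMatroid F7mat

F₇* : Matroid
F₇* = dual F₇

K₅ : Graph 5 10
K₅ = lookup ((0F , 1F) ∷ (0F , 2F) ∷ (0F , 3F) ∷ (0F , 4F) ∷ (1F , 2F) ∷
             (1F , 3F) ∷ (1F , 4F) ∷ (2F , 3F) ∷ (2F , 4F) ∷ (3F , 4F) ∷ [])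

K₃₃ : Graph 6 9
K₃₃ = lookup ((0F , 3F) ∷ (0F , 4F) ∷ (0F , 5F) ∷ (1F , 3F) ∷ (1F , 4F) ∷
              (1F , 5F) ∷ (2F , 3F) ∷ (2F , 4F) ∷ (2F , 5F) ∷ [])

M*K₅ : Matroid
M*K₅ = dual (cycleMatroid K₅)

M*K₃₃ : Matroid
M*K₃₃ = dual (cycleMatroid K₃₃)

data Excluded : Matroid → Set₁ where
  isF₇    : Excluded F₇
  isF₇*   : Excluded F₇*
  isM*K₅  : Excluded M*K₅
  isM*K₃₃ : Excluded M*K₃₃

module Submission where

-- Let A_T be A with the added row χ_T, and adjoin the unit column e₀ of that
-- row as a new element a.  Contracting T′ gives N with N \ a = M_T / T′ ≅ F and
-- N / a = M / T′, since contracting a kills the new row.  Hence N / a is a minor of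
-- M, and M is a coextension of it by the |T′| ≤ k elements of T′.  N is binary:
-- contracting T′ is realised by a linear map p whose kernel is exactly the span of
-- the columns T′, namely evaluation at all 2^R functionals vanishing on them; that
-- the kernel is no larger is the separation lemma.

open import Defs
open import Data.Nat using (ℕ; zero; suc; _≤_; _<_; _+_; _^_)
open import Data.Nat.Properties using (≤-trans; <⇒≱; +-suc; +-monoʳ-≤; m≤m+n)
open import Data.Bool using (Bool; true; false; _∧_; _xor_)
open import Data.Bool.Properties
  using (xor-same; xor-identityʳ; ∧-distribˡ-xor; ∧-distribʳ-xor; xor-∧-commutativeRing; ∧-commutativeMonoid)
  renaming (_≟_ to _≟ᴮ_)
open import Data.Fin using (Fin; zero; suc; finToFun; funToFin)
open import Data.Fin.Properties using (all?; any?; ¬∀⟶∃¬; finToFun-funToFin; suc-injective; 0≢1+n; ¬Fin0) renaming (_≟_ to _≟ᶠ_)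
open import Data.Fin.Subset using (Subset; _∈_; _∉_; _⊆_; _⊂_; _∩_; _∪_; _─_; ⊤; ⊥; ⁅_⁆; ∣_∣; Empty; Nonempty)
open import Data.Fin.Subset.Properties
  using (∉⊥; ∈⊤; ∣⊤∣≡n; x∈⁅x⁆; x∈⁅y⁆⇒x≡y; x∈p∧x∉q⇒x∈p─q; p─q⊆p; ⊆-antisym; _∈?_; anySubset?; _⊆?_; nonempty?;
         x∈p∪q⁺; x∈p∪q⁻; x∈p∩q⁺; x∈p∩q⁻; p⊆p∪q; p⊂q⇒∣p∣<∣q∣; p⊆q⇒∣p∣≤∣q∣)
open import Data.Vec using (lookup; tabulate; zipWith; _∷_; []; here; there)
open import Data.Vec.Properties using ([]=⇒lookup; lookup⇒[]=; lookup-zipWith; lookup∘tabulate)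
open import Data.Product using (Σ; ∃; ∃-syntax; _×_; _,_; proj₁; proj₂)
open import Data.Sum using (_⊎_; inj₁; inj₂)
open import Data.Sum.Function.Propositional using (_⊎-⇔_)
open import Data.Empty using (⊥-elim)
open import Relation.Nullary using (¬_; Dec; yes; no; does)
open import Relation.Nullary.Decidable using (_×-dec_; _→-dec_; ¬?; dec-true)
open import Function using (_∘_)
open import Function.Bundles using (_⇔_; mk⇔; Equivalence)
open import Function.Construct.Composition using (_⇔-∘_)
open import Function.Construct.Symmetry using (⇔-sym)
open import Relation.Binary.PropositionalEquality
  using (_≡_; _≢_; _≗_; refl; sym; trans; cong; cong₂; subst; module ≡-Reasoning)
open import Algebra.Bundles using (CommutativeRing; CommutativeMonoid)
import Algebra.Properties.CommutativeSemigroup as CommSemigroupProps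

open ≡-Reasoning

private
  module BoolRing = CommutativeRing xor-∧-commutativeRing

xor-interchange : ∀ a b c d → (a xor b) xor (c xor d) ≡ (a xor c) xor (b xor d)
xor-interchange = CommSemigroupProps.interchange BoolRing.+-commutativeSemigroup

∧-leftSwap : ∀ a b c → a ∧ (b ∧ c) ≡ b ∧ (a ∧ c)
∧-leftSwap = CommSemigroupProps.x∙yz≈y∙xz (CommutativeMonoid.commutativeSemigroup ∧-commutativeMonoid)

∧≡true⁻ : ∀ {a b} → a ∧ b ≡ true → a ≡ true × b ≡ true
∧≡true⁻ {true} {true} _ = refl , refl

xor≡false⇒≡ : ∀ {a b} → a xor b ≡ false → b ≡ a
xor≡false⇒≡ {true}  {true}  _ = refl
xor≡false⇒≡ {false} {false} _ = refl

lookup⇒∈ : ∀ {n} {x : Fin n} {p : Subset n} → lookup p x ≡ true → x ∈ p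
lookup⇒∈ {x = x} {p} = lookup⇒[]= x p

∉⇒lookup : ∀ {n} {x : Fin n} {p : Subset n} → x ∉ p → lookup p x ≡ false
∉⇒lookup {x = x} {p} x∉p with lookup p x in eq
... | true  = ⊥-elim (x∉p (lookup⇒∈ eq))
... | false = refl

∈─⇒∉ : ∀ {n} {x : Fin n} (p q : Subset n) → x ∈ p ─ q → x ∉ q
∈─⇒∉ (_ ∷ p) (true ∷ q) (there x∈) (there x∈q) = ∈─⇒∉ p q x∈ x∈q
∈─⇒∉ (_ ∷ p) (false ∷ q) (there x∈) (there x∈q) = ∈─⇒∉ p q x∈ x∈q

infixl 6 _⊕_
_⊕_ : ∀ {n} → Subset n → Subset n → Subset n
p ⊕ q = zipWith _xor_ p q

∈⊕⁻ : ∀ {n} {x : Fin n} (p q : Subset n) → x ∈ p ⊕ q → x ∈ p ⊎ x ∈ q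
∈⊕⁻ (true ∷ p) (false ∷ q) here = inj₁ here
∈⊕⁻ (false ∷ p) (true ∷ q) here = inj₂ here
∈⊕⁻ (_ ∷ p) (_ ∷ q) (there x∈) with ∈⊕⁻ p q x∈
... | inj₁ x∈p = inj₁ (there x∈p)
... | inj₂ x∈q = inj₂ (there x∈q)

∈⊕⁺ˡ : ∀ {n} {x : Fin n} {p q : Subset n} → x ∈ p → x ∉ q → x ∈ p ⊕ q
∈⊕⁺ˡ {q = false ∷ q} here x∉q = here
∈⊕⁺ˡ {q = true ∷ q} here x∉q = ⊥-elim (x∉q here)
∈⊕⁺ˡ {q = _ ∷ q} (there x∈p) x∉q = there (∈⊕⁺ˡ x∈p (λ x∈q → x∉q (there x∈q)))

∈⊕⁺ʳ : ∀ {n} {x : Fin n} {p q : Subset n} → x ∉ p → x ∈ q → x ∈ p ⊕ q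
∈⊕⁺ʳ {p = false ∷ p} x∉p here = here
∈⊕⁺ʳ {p = true ∷ p} x∉p here = ⊥-elim (x∉p here)
∈⊕⁺ʳ {p = _ ∷ p} x∉p (there x∈q) = there (∈⊕⁺ʳ (λ x∈p → x∉p (there x∈p)) x∈q)

xorSum-cong : ∀ {n} {f g : Fin n → Bool} → f ≗ g → xorSum f ≡ xorSum g
xorSum-cong {zero}  f≗g = refl
xorSum-cong {suc n} f≗g = cong₂ _xor_ (f≗g zero) (xorSum-cong (λ j → f≗g (suc j)))

xorSum-zero : ∀ {n} (f : Fin n → Bool) → (∀ j → f j ≡ false) → xorSum f ≡ false
xorSum-zero {zero}  f f≡0 = refl
xorSum-zero {suc n} f f≡0 rewrite f≡0 zero = xorSum-zero (λ j → f (suc j)) (λ j → f≡0 (suc j))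

xorSum-xor : ∀ {n} (f g : Fin n → Bool) →
             xorSum (λ j → f j xor g j) ≡ xorSum f xor xorSum g
xorSum-xor {zero}  f g = refl
xorSum-xor {suc n} f g = begin
  (f zero xor g zero) xor xorSum (λ j → f (suc j) xor g (suc j))
    ≡⟨ cong ((f zero xor g zero) xor_) (xorSum-xor (λ j → f (suc j)) (λ j → g (suc j))) ⟩
  (f zero xor g zero) xor (xorSum (λ j → f (suc j)) xor xorSum (λ j → g (suc j)))
    ≡⟨ xor-interchange (f zero) (g zero) _ _ ⟩
  xorSum f xor xorSum g ∎

xorSum-∧ : ∀ {n} b (f : Fin n → Bool) → xorSum (λ j → b ∧ f j) ≡ b ∧ xorSum f
xorSum-∧ true  f = refl
xorSum-∧ {n} false f = xorSum-zero {n} _ (λ j → refl)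

xorSum-swap : ∀ {m n} (h : Fin m → Fin n → Bool) →
  xorSum (λ j → xorSum (h j)) ≡ xorSum (λ t → xorSum (λ j → h j t))
xorSum-swap {zero} {n} h = sym (xorSum-zero {n} _ (λ t → refl))
xorSum-swap {suc m} h = begin
  xorSum (h zero) xor xorSum (λ j → xorSum (h (suc j)))
    ≡⟨ cong (xorSum (h zero) xor_) (xorSum-swap (λ j → h (suc j))) ⟩
  xorSum (h zero) xor xorSum (λ t → xorSum (λ j → h (suc j) t))
    ≡⟨ sym (xorSum-xor (h zero) (λ t → xorSum (λ j → h (suc j) t))) ⟩
  xorSum (λ t → xorSum (λ j → h j t)) ∎

xorSum-⁅⁆ : ∀ {n} (i : Fin n) (f : Fin n → Bool) → xorSum (λ j → lookup ⁅ i ⁆ j ∧ f j) ≡ f i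
xorSum-⁅⁆ zero    f = begin
  f zero xor xorSum (λ j → lookup ⊥ j ∧ f (suc j))
    ≡⟨ cong (f zero xor_) (xorSum-zero _ (λ j → cong (_∧ f (suc j)) (∉⇒lookup (∉⊥ {x = j})))) ⟩
  f zero xor false
    ≡⟨ xor-identityʳ (f zero) ⟩
  f zero ∎
xorSum-⁅⁆ (suc i) f = xorSum-⁅⁆ i (λ j → f (suc j))

Vector : ℕ → Set
Vector R = Fin R → Bool

0ᵛ : ∀ {R} → Vector R
0ᵛ _ = false

infixl 6 _+ᵛ_
_+ᵛ_ : ∀ {R} → Vector R → Vector R → Vector R
(u +ᵛ w) t = u t xor w t

col : ∀ {R n} → Matrix R n → Fin n → Vector R
col C j t = C t j

combination : ∀ {R n} → Subset n → (Fin n → Vector R) → Vector R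
combination Z u t = xorSum (λ j → lookup Z j ∧ u j t)

combination-⊕ : ∀ {R n} (p q : Subset n) (u : Fin n → Vector R) →
                combination (p ⊕ q) u ≗ combination p u +ᵛ combination q u
combination-⊕ p q u t = begin
  xorSum (λ j → lookup (p ⊕ q) j ∧ u j t)
    ≡⟨ xorSum-cong (λ j → cong (_∧ u j t) (lookup-zipWith _xor_ j p q)) ⟩
  xorSum (λ j → (lookup p j xor lookup q j) ∧ u j t)
    ≡⟨ xorSum-cong (λ j → ∧-distribʳ-xor (u j t) (lookup p j) (lookup q j)) ⟩
  xorSum (λ j → (lookup p j ∧ u j t) xor (lookup q j ∧ u j t))
    ≡⟨ xorSum-xor (λ j → lookup p j ∧ u j t) (λ j → lookup q j ∧ u j t) ⟩
  combination p u t xor combination q u t ∎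

combination-⁅⁆ : ∀ {R n} (i : Fin n) (u : Fin n → Vector R) → combination ⁅ i ⁆ u ≗ u i
combination-⁅⁆ i u t = xorSum-⁅⁆ i (λ j → u j t)

combination-empty : ∀ {R n} (Z : Subset n) (u : Fin n → Vector R) → Empty Z → combination Z u ≗ 0ᵛ
combination-empty Z u Z-empty t =
  xorSum-zero _ (λ j → cong (_∧ u j t) (∉⇒lookup (λ j∈Z → Z-empty (j , j∈Z))))

combination-remove : ∀ {R n} (Z : Subset n) (u : Fin n → Vector R) {i} → i ∈ Z →
                     combination Z u ≗ u i +ᵛ combination (Z ─ ⁅ i ⁆) u
combination-remove Z u {i} i∈Z t = begin
  combination Z u t
    ≡⟨ cong (λ Z′ → combination Z′ u t) Z≡ ⟩
  combination (⁅ i ⁆ ⊕ (Z ─ ⁅ i ⁆)) u t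
    ≡⟨ combination-⊕ ⁅ i ⁆ (Z ─ ⁅ i ⁆) u t ⟩
  combination ⁅ i ⁆ u t xor combination (Z ─ ⁅ i ⁆) u t
    ≡⟨ cong (_xor combination (Z ─ ⁅ i ⁆) u t) (combination-⁅⁆ i u t) ⟩
  u i t xor combination (Z ─ ⁅ i ⁆) u t ∎
  where
  Z≡ : Z ≡ ⁅ i ⁆ ⊕ (Z ─ ⁅ i ⁆)
  Z≡ = ⊆-antisym into onto
    where
    into : Z ⊆ ⁅ i ⁆ ⊕ (Z ─ ⁅ i ⁆)
    into {j} j∈Z with j ≟ᶠ i
    ... | yes refl = ∈⊕⁺ˡ (x∈⁅x⁆ i) (λ i∈Z─i → ∈─⇒∉ Z ⁅ i ⁆ i∈Z─i (x∈⁅x⁆ i))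
    ... | no j≢i   = ∈⊕⁺ʳ (λ j∈i → j≢i (x∈⁅y⁆⇒x≡y i j∈i))
                          (x∈p∧x∉q⇒x∈p─q j∈Z (λ j∈i → j≢i (x∈⁅y⁆⇒x≡y i j∈i)))
    onto : ⁅ i ⁆ ⊕ (Z ─ ⁅ i ⁆) ⊆ Z
    onto j∈ with ∈⊕⁻ ⁅ i ⁆ (Z ─ ⁅ i ⁆) j∈
    ... | inj₁ j∈i rewrite x∈⁅y⁆⇒x≡y i j∈i = i∈Z
    ... | inj₂ j∈Z─i = p─q⊆p Z ⁅ i ⁆ j∈Z─i

combination-closed : ∀ {R m} (P : Vector R → Set) →
  (∀ {u w} → u ≗ w → P u → P w) → P 0ᵛ → (∀ {u w} → P u → P w → P (u +ᵛ w)) →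
  (u : Fin m → Vector R) (W : Subset m) → (∀ j → j ∈ W → P (u j)) → P (combination W u)
combination-closed P resp P0 P+ u [] _ = resp (λ t → refl) P0
combination-closed P resp P0 P+ u (true ∷ W) Pu =
  P+ (Pu zero here) (combination-closed P resp P0 P+ (λ j → u (suc j)) W (λ j j∈ → Pu (suc j) (there j∈)))
combination-closed P resp P0 P+ u (false ∷ W) Pu =
  combination-closed P resp P0 P+ (λ j → u (suc j)) W (λ j j∈ → Pu (suc j) (there j∈))

dot : ∀ {R} → Vector R → Vector R → Bool
dot φ v = xorSum (λ t → φ t ∧ v t)

dot-congˡ : ∀ {R} {φ ψ : Vector R} (v : Vector R) → φ ≗ ψ → dot φ v ≡ dot ψ v
dot-congˡ v φ≗ψ = xorSum-cong (λ t → cong (_∧ v t) (φ≗ψ t))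

dot-congʳ : ∀ {R} (φ : Vector R) {u w : Vector R} → u ≗ w → dot φ u ≡ dot φ w
dot-congʳ φ u≗w = xorSum-cong (λ t → cong (φ t ∧_) (u≗w t))

dot-+ˡ : ∀ {R} (φ ψ v : Vector R) → dot (φ +ᵛ ψ) v ≡ dot φ v xor dot ψ v
dot-+ˡ φ ψ v = trans (xorSum-cong (λ t → ∧-distribʳ-xor (v t) (φ t) (ψ t)))
                     (xorSum-xor (λ t → φ t ∧ v t) (λ t → ψ t ∧ v t))

dot-+ʳ : ∀ {R} (φ u w : Vector R) → dot φ (u +ᵛ w) ≡ dot φ u xor dot φ w
dot-+ʳ φ u w = trans (xorSum-cong (λ t → ∧-distribˡ-xor (φ t) (u t) (w t)))
                     (xorSum-xor (λ t → φ t ∧ u t) (λ t → φ t ∧ w t))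

dot-combination : ∀ {R m} (φ : Vector R) (Z : Subset m) (u : Fin m → Vector R) →
  dot φ (combination Z u) ≡ xorSum (λ j → lookup Z j ∧ dot φ (u j))
dot-combination {R} {m} φ Z u = begin
  xorSum (λ t → φ t ∧ xorSum (λ j → lookup Z j ∧ u j t))
    ≡⟨ xorSum-cong (λ t → sym (xorSum-∧ (φ t) (λ j → lookup Z j ∧ u j t))) ⟩
  xorSum (λ t → xorSum (λ j → φ t ∧ (lookup Z j ∧ u j t)))
    ≡⟨ xorSum-swap (λ t j → φ t ∧ (lookup Z j ∧ u j t)) ⟩
  xorSum (λ j → xorSum (λ t → φ t ∧ (lookup Z j ∧ u j t)))
    ≡⟨ xorSum-cong (λ j → xorSum-cong (λ t → ∧-leftSwap (φ t) (lookup Z j) (u j t))) ⟩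
  xorSum (λ j → xorSum (λ t → lookup Z j ∧ (φ t ∧ u j t)))
    ≡⟨ xorSum-cong (λ j → xorSum-∧ (lookup Z j) (λ t → φ t ∧ u j t)) ⟩
  xorSum (λ j → lookup Z j ∧ dot φ (u j)) ∎

InSpan : ∀ {R n} → Matrix R n → Subset n → Vector R → Set
InSpan C X v = ∃ λ W → W ⊆ X × colSum C W ≗ v

inSpan? : ∀ {R n} (C : Matrix R n) X v → Dec (InSpan C X v)
inSpan? C X v = anySubset? (λ W → (W ⊆? X) ×-dec all? (λ t → colSum C W t ≟ᴮ v t))

inSpan-resp : ∀ {R n} (C : Matrix R n) {X u w} → u ≗ w → InSpan C X u → InSpan C X w
inSpan-resp C u≗w (W , W⊆X , sum≗u) = W , W⊆X , (λ t → trans (sum≗u t) (u≗w t))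

inSpan-0 : ∀ {R n} (C : Matrix R n) X → InSpan C X 0ᵛ
inSpan-0 C X = ⊥ , (λ j∈⊥ → ⊥-elim (∉⊥ j∈⊥)) , combination-empty ⊥ (col C) (λ (_ , j∈⊥) → ∉⊥ j∈⊥)

inSpan-+ : ∀ {R n} (C : Matrix R n) {X u w} → InSpan C X u → InSpan C X w → InSpan C X (u +ᵛ w)
inSpan-+ C {X} (W₁ , W₁⊆X , sum₁) (W₂ , W₂⊆X , sum₂) =
  W₁ ⊕ W₂ , W₁⊕W₂⊆X , (λ t → trans (combination-⊕ W₁ W₂ (col C) t) (cong₂ _xor_ (sum₁ t) (sum₂ t)))
  where
  W₁⊕W₂⊆X : W₁ ⊕ W₂ ⊆ X
  W₁⊕W₂⊆X j∈ with ∈⊕⁻ W₁ W₂ j∈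
  ... | inj₁ j∈W₁ = W₁⊆X j∈W₁
  ... | inj₂ j∈W₂ = W₂⊆X j∈W₂

inSpan-col : ∀ {R n} (C : Matrix R n) {X i} → i ∈ X → InSpan C X (col C i)
inSpan-col C {X} {i} i∈X =
  ⁅ i ⁆ , (λ j∈i → subst (_∈ X) (sym (x∈⁅y⁆⇒x≡y i j∈i)) i∈X) , combination-⁅⁆ i (col C)

inSpan-combination : ∀ {R n} (C : Matrix R n) {X} W → (∀ j → j ∈ W → InSpan C X (col C j)) →
                     InSpan C X (colSum C W)
inSpan-combination C {X} =
  combination-closed (InSpan C X) (inSpan-resp C) (inSpan-0 C X) (inSpan-+ C) (col C)

inSpan-⁅⁆ : ∀ {R n} (C : Matrix R n) i v → InSpan C ⁅ i ⁆ v ⇔ (v ≗ 0ᵛ ⊎ v ≗ col C i)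
inSpan-⁅⁆ C i v = mk⇔ spanned spans
  where
  spanned : InSpan C ⁅ i ⁆ v → v ≗ 0ᵛ ⊎ v ≗ col C i
  spanned (W , W⊆i , sum≗v) with i ∈? W
  ... | yes i∈W = inj₂ (λ t → begin
    v t                  ≡⟨ sym (sum≗v t) ⟩
    colSum C W t         ≡⟨ cong (λ W′ → colSum C W′ t) W≡i ⟩
    colSum C ⁅ i ⁆ t     ≡⟨ combination-⁅⁆ i (col C) t ⟩
    col C i t            ∎)
    where
    W≡i : W ≡ ⁅ i ⁆
    W≡i = ⊆-antisym W⊆i (λ j∈i → subst (_∈ W) (sym (x∈⁅y⁆⇒x≡y i j∈i)) i∈W)
  ... | no  i∉W = inj₁ (λ t → trans (sym (sum≗v t)) (combination-empty W (col C) W-empty t))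
    where
    W-empty : Empty W
    W-empty (j , j∈W) = i∉W (subst (_∈ W) (x∈⁅y⁆⇒x≡y i (W⊆i j∈W)) j∈W)
  spans : v ≗ 0ᵛ ⊎ v ≗ col C i → InSpan C ⁅ i ⁆ v
  spans (inj₁ v≗0) = inSpan-resp C (λ t → sym (v≗0 t)) (inSpan-0 C ⁅ i ⁆)
  spans (inj₂ v≗i) = inSpan-resp C (λ t → sym (v≗i t)) (inSpan-col C (x∈⁅x⁆ i))

e₀ : ∀ {r} → Vector (suc r)
e₀ zero    = true
e₀ (suc _) = false

inSpan-addRow : ∀ {r n} (A : Matrix r n) (T X : Subset n) (v : Vector (suc r)) →
  InSpan A X (v ∘ suc) ⇔ (InSpan (addRow A T) X v ⊎ InSpan (addRow A T) X (v +ᵛ e₀))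
inSpan-addRow A T X v = mk⇔ lift restrict
  where
  flip-bit : ∀ {a b} → a ≢ b → a ≡ b xor true
  flip-bit {true}  {false} _ = refl
  flip-bit {false} {true}  _ = refl
  flip-bit {true}  {true}  a≢b = ⊥-elim (a≢b refl)
  flip-bit {false} {false} a≢b = ⊥-elim (a≢b refl)
  lift : InSpan A X (v ∘ suc) → InSpan (addRow A T) X v ⊎ InSpan (addRow A T) X (v +ᵛ e₀)
  lift (W , W⊆X , sum) with colSum (addRow A T) W zero ≟ᴮ v zero
  ... | yes top≡ = inj₁ (W , W⊆X , λ { zero → top≡ ; (suc t) → sum t })
  ... | no  top≢ = inj₂ (W , W⊆X , λ { zero → flip-bit top≢ ; (suc t) → trans (sum t) (sym (xor-identityʳ _)) })
  restrict : InSpan (addRow A T) X v ⊎ InSpan (addRow A T) X (v +ᵛ e₀) → InSpan A X (v ∘ suc)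
  restrict (inj₁ (W , W⊆X , sum)) = W , W⊆X , (λ t → sum (suc t))
  restrict (inj₂ (W , W⊆X , sum)) = W , W⊆X , (λ t → trans (sum (suc t)) (xor-identityʳ _))

Dependency : ∀ {R n} → Matrix R n → Subset n → Subset n → Set
Dependency C X Y = Y ⊆ X × Nonempty Y × colSum C Y ≗ 0ᵛ

dependency? : ∀ {R n} (C : Matrix R n) X → Dec (∃ (Dependency C X))
dependency? C X =
  anySubset? (λ Y → (Y ⊆? X) ×-dec (nonempty? Y ×-dec all? (λ t → colSum C Y t ≟ᴮ false)))

linIndep? : ∀ {R n} (C : Matrix R n) X → Dec (LinIndep C X)
linIndep? C X with dependency? C X
... | yes (Y , Y⊆X , Y≢∅ , Y≗0) = no (λ indep → indep Y Y⊆X Y≢∅ Y≗0)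
... | no ¬dep                  = yes (λ Y Y⊆X Y≢∅ Y≗0 → ¬dep (Y , Y⊆X , Y≢∅ , Y≗0))

dependency-of : ∀ {R n} (C : Matrix R n) {X} → ¬ LinIndep C X → ∃ (Dependency C X)
dependency-of C {X} ¬indep with dependency? C X
... | yes dep  = dep
... | no ¬dep  = ⊥-elim (¬indep (λ Y Y⊆X Y≢∅ Y≗0 → ¬dep (Y , Y⊆X , Y≢∅ , Y≗0)))

linIndep-⊆ : ∀ {R n} (C : Matrix R n) {X Y} → Y ⊆ X → LinIndep C X → LinIndep C Y
linIndep-⊆ C Y⊆X indep Z Z⊆Y = indep Z (λ j∈Z → Y⊆X (Z⊆Y j∈Z))

Annihilates : ∀ {R n} → Matrix R n → Subset n → Vector R → Set
Annihilates C X φ = ∀ j → j ∈ X → dot φ (col C j) ≡ false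

-- The inductive step of the separation lemma: from φ₁ with φ₁(w) = 1 and φ₂ with
-- φ₂(w + c) = 1 one obtains φ with φ(c) = 0 and φ(w) = 1 vanishing wherever both do.
combine-separators : ∀ {R} (c w φ₁ φ₂ : Vector R) → dot φ₁ w ≡ true → dot φ₂ (w +ᵛ c) ≡ true →
  ∃ λ φ → (∀ v → dot φ₁ v ≡ false → dot φ₂ v ≡ false → dot φ v ≡ false) ×
          dot φ c ≡ false × dot φ w ≡ true
combine-separators c w φ₁ φ₂ φ₁w φ₂wc with dot φ₁ c in φ₁c | dot φ₂ c in φ₂c
... | false | _     = φ₁ , (λ v φ₁v _ → φ₁v) , φ₁c , φ₁w
... | true  | false = φ₂ , (λ v _ φ₂v → φ₂v) , φ₂c , (begin
  dot φ₂ w             ≡⟨ sym (xor-identityʳ _) ⟩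
  dot φ₂ w xor false   ≡⟨ cong (dot φ₂ w xor_) (sym φ₂c) ⟩
  dot φ₂ w xor dot φ₂ c ≡⟨ sym (dot-+ʳ φ₂ w c) ⟩
  dot φ₂ (w +ᵛ c)      ≡⟨ φ₂wc ⟩
  true                 ∎)
... | true  | true  = φ₁ +ᵛ φ₂ , vanish , φc , φw
  where
  vanish : ∀ v → dot φ₁ v ≡ false → dot φ₂ v ≡ false → dot (φ₁ +ᵛ φ₂) v ≡ false
  vanish v φ₁v φ₂v = trans (dot-+ˡ φ₁ φ₂ v) (cong₂ _xor_ φ₁v φ₂v)
  φc : dot (φ₁ +ᵛ φ₂) c ≡ false
  φc = trans (dot-+ˡ φ₁ φ₂ c) (cong₂ _xor_ φ₁c φ₂c)
  φ₂w : dot φ₂ w ≡ false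
  φ₂w = flipped (trans (sym (cong (dot φ₂ w xor_) φ₂c)) (trans (sym (dot-+ʳ φ₂ w c)) φ₂wc))
    where
    flipped : ∀ {a} → a xor true ≡ true → a ≡ false
    flipped {false} _ = refl
  φw : dot (φ₁ +ᵛ φ₂) w ≡ true
  φw = trans (dot-+ˡ φ₁ φ₂ w) (cong₂ _xor_ φ₁w φ₂w)

xor-cancel-outer : ∀ c w → c xor (w xor c) ≡ w
xor-cancel-outer true  true  = refl
xor-cancel-outer true  false = refl
xor-cancel-outer false w     = xor-identityʳ w

dropColumn : ∀ {R n} → Matrix R (suc n) → Matrix R n
dropColumn C t j = C t (suc j)

inSpan-dropColumn : ∀ {R n} (C : Matrix R (suc n)) {X v} b → InSpan (dropColumn C) X v → InSpan C (b ∷ X) v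
inSpan-dropColumn C b (W , W⊆X , sum) = false ∷ W , (λ { (there j∈W) → there (W⊆X j∈W) }) , sum

inSpan-dropColumn-+ : ∀ {R n} (C : Matrix R (suc n)) {X v} →
  InSpan (dropColumn C) X (v +ᵛ col C zero) → InSpan C (true ∷ X) v
inSpan-dropColumn-+ C {v = v} (W , W⊆X , sum) =
  true ∷ W , (λ { here → here ; (there j∈W) → there (W⊆X j∈W) }) ,
  (λ t → trans (cong (C t zero xor_) (sum t)) (xor-cancel-outer (C t zero) (v t)))

separation : ∀ {R n} (C : Matrix R n) X w → ¬ InSpan C X w →
             ∃ λ φ → Annihilates C X φ × dot φ w ≡ true
separation {R} {zero} C [] w w∉ with ¬∀⟶∃¬ R (λ t → w t ≡ false) (λ t → w t ≟ᴮ false) w≢0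
  where
  w≢0 : ¬ (∀ t → w t ≡ false)
  w≢0 w≡0 = w∉ ([] , (λ ()) , (λ t → sym (w≡0 t)))
... | t , wt≢0 = lookup ⁅ t ⁆ , (λ j ()) , trans (xorSum-⁅⁆ t w) (¬false wt≢0)
  where
  ¬false : ∀ {b} → b ≢ false → b ≡ true
  ¬false {true}  _   = refl
  ¬false {false} b≢0 = ⊥-elim (b≢0 refl)
separation {n = suc n} C (false ∷ X) w w∉
  with separation (dropColumn C) X w (w∉ ∘ inSpan-dropColumn C false)
... | φ , ann , φw = φ , (λ { (suc j) (there j∈X) → ann j j∈X }) , φw
separation {n = suc n} C (true ∷ X) w w∉
  with separation (dropColumn C) X w (w∉ ∘ inSpan-dropColumn C true)
     | separation (dropColumn C) X (w +ᵛ col C zero) (w∉ ∘ inSpan-dropColumn-+ C)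
... | φ₁ , ann₁ , φ₁w | φ₂ , ann₂ , φ₂wc with combine-separators (col C zero) w φ₁ φ₂ φ₁w φ₂wc
... | φ , vanish , φc , φw = φ , ann , φw
  where
  ann : Annihilates C (true ∷ X) φ
  ann zero    _           = φc
  ann (suc j) (there j∈X) = vanish (col C (suc j)) (ann₁ j j∈X) (ann₂ j j∈X)

bit : Fin 2 → Bool
bit zero    = false
bit (suc _) = true

fromBit : Bool → Fin 2
fromBit false = zero
fromBit true  = suc zero

bit-fromBit : ∀ b → bit (fromBit b) ≡ b
bit-fromBit false = refl
bit-fromBit true  = refl

-- Projection of GF(2)^R onto the quotient by the span of the columns X of C.
-- Coordinates are indexed by all 2^R functionals; the coordinate of v at φ is φ(v)
-- if φ annihilates the columns X, and 0 otherwise.  By the separation lemma the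
-- kernel of this linear map is exactly the span of the columns X.
module Quotient {R n} (C : Matrix R n) (X : Subset n) where

  functional : Fin (2 ^ R) → Vector R
  functional i t = bit (finToFun i t)

  index : Vector R → Fin (2 ^ R)
  index φ = funToFin (λ t → fromBit (φ t))

  functional-index : ∀ φ → functional (index φ) ≗ φ
  functional-index φ t = trans (cong bit (finToFun-funToFin (λ t → fromBit (φ t)) t)) (bit-fromBit (φ t))

  annihilates? : ∀ φ → Dec (Annihilates C X φ)
  annihilates? φ = all? (λ j → (j ∈? X) →-dec (dot φ (col C j) ≟ᴮ false))

  annihilates-true : ∀ φ → does (annihilates? φ) ≡ true → Annihilates C X φ
  annihilates-true φ = witness (annihilates? φ)
    where
    witness : ∀ {A : Set} (d : Dec A) → does d ≡ true → A
    witness (yes a) _ = a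

  project : Vector R → Vector (2 ^ R)
  project v i = does (annihilates? (functional i)) ∧ dot (functional i) v

  project-cong : ∀ {u w} → u ≗ w → project u ≗ project w
  project-cong u≗w i = cong (does (annihilates? (functional i)) ∧_) (dot-congʳ (functional i) u≗w)

  project-+ : ∀ u w → project (u +ᵛ w) ≗ project u +ᵛ project w
  project-+ u w i = trans (cong (does (annihilates? (functional i)) ∧_) (dot-+ʳ (functional i) u w))
                          (∧-distribˡ-xor (does (annihilates? (functional i))) _ _)

  project-span : ∀ {v} → InSpan C X v → project v ≗ 0ᵛ
  project-span {v} (W , W⊆X , sum≗v) i = mask-vanishes (does (annihilates? φ)) φv≡0
    where
    φ = functional i
    mask-vanishes : ∀ a {b} → (a ≡ true → b ≡ false) → a ∧ b ≡ false
    mask-vanishes false _ = refl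
    mask-vanishes true  f = f refl
    φv≡0 : does (annihilates? φ) ≡ true → dot φ v ≡ false
    φv≡0 a≡1 = begin
      dot φ v                                     ≡⟨ sym (dot-congʳ φ sum≗v) ⟩
      dot φ (colSum C W)                          ≡⟨ dot-combination φ W (col C) ⟩
      xorSum (λ j → lookup W j ∧ dot φ (col C j)) ≡⟨ xorSum-zero _ vanish ⟩
      false                                       ∎
      where
      vanish : ∀ j → lookup W j ∧ dot φ (col C j) ≡ false
      vanish j with lookup W j in j∈W
      ... | false = refl
      ... | true  = annihilates-true φ a≡1 j (W⊆X (lookup⇒∈ j∈W))

  project-kernel : ∀ {v} → project v ≗ 0ᵛ → InSpan C X v
  project-kernel {v} v↦0 with inSpan? C X v
  ... | yes v∈ = v∈
  ... | no  v∉ with separation C X v v∉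
  ...   | φ , ann , φv≡1 = ⊥-elim (true≢false (begin
    true                                                   ≡⟨ cong₂ _∧_ (sym (dec-true (annihilates? ψ) annψ)) (sym φv≡1) ⟩
    does (annihilates? ψ) ∧ dot φ v                        ≡⟨ cong (does (annihilates? ψ) ∧_) (sym (dot-congˡ v (functional-index φ))) ⟩
    project v (index φ)                                    ≡⟨ v↦0 (index φ) ⟩
    false                                                  ∎))
    where
    ψ = functional (index φ)
    annψ : Annihilates C X ψ
    annψ j j∈X = trans (dot-congˡ (col C j) (functional-index φ)) (ann j j∈X)
    true≢false : true ≢ false
    true≢false ()

  kernel : ∀ v → project v ≗ 0ᵛ ⇔ InSpan C X v
  kernel v = mk⇔ project-kernel project-span

  project-≗ : ∀ u w → project u ≗ project w ⇔ InSpan C X (u +ᵛ w)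
  project-≗ u w = kernel (u +ᵛ w) ⇔-∘ mk⇔ equal⇒sum sum⇒equal
    where
    equal⇒sum : project u ≗ project w → project (u +ᵛ w) ≗ 0ᵛ
    equal⇒sum pu≗pw i = begin
      project (u +ᵛ w) i             ≡⟨ project-+ u w i ⟩
      project u i xor project w i    ≡⟨ cong (_xor project w i) (pu≗pw i) ⟩
      project w i xor project w i    ≡⟨ xor-same (project w i) ⟩
      false                          ∎
    sum⇒equal : project (u +ᵛ w) ≗ 0ᵛ → project u ≗ project w
    sum⇒equal sum≗0 i = sym (xor≡false⇒≡ (trans (sym (project-+ u w i)) (sum≗0 i)))

  projectMatrix : ∀ {m} → (Fin m → Vector R) → Matrix (2 ^ R) m
  projectMatrix u i j = project (u j) i

  colSum-projectMatrix : ∀ {m} (u : Fin m → Vector R) Z → colSum (projectMatrix u) Z ≗ project (combination Z u)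
  colSum-projectMatrix u Z i = begin
    xorSum (λ j → lookup Z j ∧ (a ∧ dot φ (u j)))  ≡⟨ xorSum-cong (λ j → ∧-leftSwap (lookup Z j) a (dot φ (u j))) ⟩
    xorSum (λ j → a ∧ (lookup Z j ∧ dot φ (u j)))  ≡⟨ xorSum-∧ a (λ j → lookup Z j ∧ dot φ (u j)) ⟩
    a ∧ xorSum (λ j → lookup Z j ∧ dot φ (u j))    ≡⟨ cong (a ∧_) (sym (dot-combination φ Z u)) ⟩
    a ∧ dot φ (combination Z u)                    ∎
    where
    φ = functional i
    a = does (annihilates? φ)

disjoint-split : ∀ {n} {Y P Q : Subset n} → Y ⊆ P ∪ Q → Empty (P ∩ Q) → Y ≡ (Y ∩ P) ⊕ (Y ∩ Q)
disjoint-split {Y = Y} {P} {Q} Y⊆P∪Q disjoint = ⊆-antisym into onto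
  where
  into : Y ⊆ (Y ∩ P) ⊕ (Y ∩ Q)
  into {x} x∈Y with x∈p∪q⁻ P Q (Y⊆P∪Q x∈Y)
  ... | inj₁ x∈P = ∈⊕⁺ˡ (x∈p∩q⁺ (x∈Y , x∈P))
                        (λ x∈Y∩Q → disjoint (x , x∈p∩q⁺ (x∈P , proj₂ (x∈p∩q⁻ Y Q x∈Y∩Q))))
  ... | inj₂ x∈Q = ∈⊕⁺ʳ (λ x∈Y∩P → disjoint (x , x∈p∩q⁺ (proj₂ (x∈p∩q⁻ Y P x∈Y∩P) , x∈Q)))
                        (x∈p∩q⁺ (x∈Y , x∈Q))
  onto : (Y ∩ P) ⊕ (Y ∩ Q) ⊆ Y
  onto x∈ with ∈⊕⁻ (Y ∩ P) (Y ∩ Q) x∈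
  ... | inj₁ x∈Y∩P = proj₁ (x∈p∩q⁻ Y P x∈Y∩P)
  ... | inj₂ x∈Y∩Q = proj₁ (x∈p∩q⁻ Y Q x∈Y∩Q)

-- Free P I: no nonempty subset of I has property P.  Linear independence is
-- Free (sum is zero); independence modulo X is Free (sum lies in the span of X).
Free : ∀ {n} → (Subset n → Set) → Subset n → Set
Free P I = ∀ Z → Z ⊆ I → Nonempty Z → ¬ P Z

module VectorMatroid {R n} (C : Matrix R n) where

  private
    M = vecMatroid C

  add-⊆ : ∀ {B S : Subset n} {x} → B ⊆ S → x ∈ S → B ∪ ⁅ x ⁆ ⊆ S
  add-⊆ {B} {x = x} B⊆S x∈S y∈ with x∈p∪q⁻ B ⁅ x ⁆ y∈
  ... | inj₁ y∈B = B⊆S y∈B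
  ... | inj₂ y∈x = subst (_∈ _) (sym (x∈⁅y⁆⇒x≡y x y∈x)) x∈S

  -- Greedy extension of an independent B ⊆ S to a basis of S; the fuel bounds the
  -- number of elements that can still be added.
  extend-to-basis : ∀ fuel S B → B ⊆ S → LinIndep C B → n ≤ fuel + ∣ B ∣ → ∃ (IsBasisOf M S)
  extend-to-basis fuel S B B⊆S indepB room
    with any? (λ x → (x ∈? S) ×-dec (¬? (x ∈? B)) ×-dec linIndep? C (B ∪ ⁅ x ⁆))
  ... | yes (x , x∈S , x∉B , indepBx) = step fuel room
    where
    B⊂Bx : B ⊂ B ∪ ⁅ x ⁆
    B⊂Bx = p⊆p∪q ⁅ x ⁆ , x , x∈p∪q⁺ (inj₂ (x∈⁅x⁆ x)) , x∉B
    ∣B∣<n : ∣ B ∣ < n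
    ∣B∣<n = subst (∣ B ∣ <_) (∣⊤∣≡n n) (p⊂q⇒∣p∣<∣q∣ ((λ _ → ∈⊤) , x , ∈⊤ , x∉B))
    step : ∀ f → n ≤ f + ∣ B ∣ → ∃ (IsBasisOf M S)
    step zero    room = ⊥-elim (<⇒≱ ∣B∣<n room)
    step (suc f) room = extend-to-basis f S (B ∪ ⁅ x ⁆) (add-⊆ B⊆S x∈S) indepBx
      (≤-trans room (subst (_≤ f + ∣ B ∪ ⁅ x ⁆ ∣) (+-suc f ∣ B ∣) (+-monoʳ-≤ f (p⊂q⇒∣p∣<∣q∣ B⊂Bx))))
  ... | no nothing-to-add = B , B⊆S , ((λ _ → ∈⊤) , indepB) , maximal
    where
    maximal : ∀ B′ → B ⊆ B′ → B′ ⊆ S → Indep M B′ → B′ ⊆ B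
    maximal B′ B⊆B′ B′⊆S (_ , indepB′) {x} x∈B′ with x ∈? B
    ... | yes x∈B = x∈B
    ... | no  x∉B = ⊥-elim (nothing-to-add
            (x , B′⊆S x∈B′ , x∉B , linIndep-⊆ C (add-⊆ B⊆B′ x∈B′) indepB′))

  basisOf : ∀ S → ∃ (IsBasisOf M S)
  basisOf S = extend-to-basis n S ⊥ (λ x∈⊥ → ⊥-elim (∉⊥ x∈⊥)) (λ Y Y⊆⊥ (_ , y∈Y) _ → ∉⊥ (Y⊆⊥ y∈Y))
                              (m≤m+n n _)

  basis-spans : ∀ {X B} → IsBasisOf M (X ∩ ⊤) B → ∀ {x} → x ∈ X → InSpan C B (col C x)
  basis-spans {X} {B} (B⊆X∩⊤ , (_ , indepB) , maximal) {x} x∈X with x ∈? B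
  ... | yes x∈B = inSpan-col C x∈B
  ... | no  x∉B with linIndep? C (B ∪ ⁅ x ⁆)
  ...   | yes indepBx = ⊥-elim (x∉B (maximal (B ∪ ⁅ x ⁆) (p⊆p∪q ⁅ x ⁆)
                          (add-⊆ B⊆X∩⊤ (x∈p∩q⁺ (x∈X , ∈⊤))) ((λ _ → ∈⊤) , indepBx)
                          (x∈p∪q⁺ (inj₂ (x∈⁅x⁆ x)))))
  ...   | no  depBx with dependency-of C depBx
  ...     | Y , Y⊆Bx , Y≢∅ , Y≗0 with x ∈? Y
  ...       | no  x∉Y = ⊥-elim (indepB Y Y⊆B Y≢∅ Y≗0)
    where
    Y⊆B : Y ⊆ B
    Y⊆B y∈Y with x∈p∪q⁻ B ⁅ x ⁆ (Y⊆Bx y∈Y)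
    ... | inj₁ y∈B = y∈B
    ... | inj₂ y∈x = ⊥-elim (x∉Y (subst (_∈ Y) (x∈⁅y⁆⇒x≡y x y∈x) y∈Y))
  ...       | yes x∈Y = Y ─ ⁅ x ⁆ , Y─x⊆B ,
                (λ t → xor≡false⇒≡ (trans (sym (combination-remove Y (col C) x∈Y t)) (Y≗0 t)))
    where
    Y─x⊆B : Y ─ ⁅ x ⁆ ⊆ B
    Y─x⊆B y∈ with x∈p∪q⁻ B ⁅ x ⁆ (Y⊆Bx (p─q⊆p Y ⁅ x ⁆ y∈))
    ... | inj₁ y∈B = y∈B
    ... | inj₂ y∈x = ⊥-elim (∈─⇒∉ Y ⁅ x ⁆ y∈ y∈x)

  IndepModulo : Subset n → Subset n → Set
  IndepModulo X = Free (λ Z → InSpan C X (colSum C Z))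

  contract-indep⇒ : ∀ X I → Indep (contract M X) I → IndepModulo X I
  contract-indep⇒ X I (_ , I∩X≡∅ , B , basis , (_ , indepI∪B)) Z Z⊆I (z , z∈Z) (W , W⊆X , sumW≗sumZ) =
    indepI∪B (Z ⊕ W′) Z⊕W′⊆I∪B (z , ∈⊕⁺ˡ z∈Z z∉W′) sum≗0
    where
    B⊆X : B ⊆ X
    B⊆X b∈B = proj₁ (x∈p∩q⁻ X ⊤ (proj₁ basis b∈B))
    ΣW∈spanB : InSpan C B (colSum C W)
    ΣW∈spanB = inSpan-combination C W (λ j j∈W → basis-spans basis (W⊆X j∈W))
    W′ = proj₁ ΣW∈spanB
    W′⊆B : W′ ⊆ B
    W′⊆B = proj₁ (proj₂ ΣW∈spanB)
    sumW′ : colSum C W′ ≗ colSum C W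
    sumW′ = proj₂ (proj₂ ΣW∈spanB)
    z∉W′ : z ∉ W′
    z∉W′ z∈W′ = I∩X≡∅ (z , x∈p∩q⁺ (Z⊆I z∈Z , B⊆X (W′⊆B z∈W′)))
    Z⊕W′⊆I∪B : Z ⊕ W′ ⊆ I ∪ B
    Z⊕W′⊆I∪B x∈ with ∈⊕⁻ Z W′ x∈
    ... | inj₁ x∈Z  = x∈p∪q⁺ (inj₁ (Z⊆I x∈Z))
    ... | inj₂ x∈W′ = x∈p∪q⁺ (inj₂ (W′⊆B x∈W′))
    sum≗0 : colSum C (Z ⊕ W′) ≗ 0ᵛ
    sum≗0 t = begin
      colSum C (Z ⊕ W′) t              ≡⟨ combination-⊕ Z W′ (col C) t ⟩
      colSum C Z t xor colSum C W′ t   ≡⟨ cong (colSum C Z t xor_) (trans (sumW′ t) (sumW≗sumZ t)) ⟩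
      colSum C Z t xor colSum C Z t    ≡⟨ xor-same (colSum C Z t) ⟩
      false                            ∎

  contract-indep⇐ : ∀ X I → I ⊆ ⊤ ─ X → IndepModulo X I → Indep (contract M X) I
  contract-indep⇐ X I I⊆E indepMod = I⊆E , I∩X≡∅ , B , basis , ((λ _ → ∈⊤) , indepI∪B)
    where
    B = proj₁ (basisOf (X ∩ ⊤))
    basis = proj₂ (basisOf (X ∩ ⊤))
    B⊆X : B ⊆ X
    B⊆X b∈B = proj₁ (x∈p∩q⁻ X ⊤ (proj₁ basis b∈B))
    I∩X≡∅ : Empty (I ∩ X)
    I∩X≡∅ (x , x∈I∩X) = ∈─⇒∉ ⊤ X (I⊆E (proj₁ (x∈p∩q⁻ I X x∈I∩X))) (proj₂ (x∈p∩q⁻ I X x∈I∩X))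
    I∩B≡∅ : Empty (I ∩ B)
    I∩B≡∅ (x , x∈I∩B) = I∩X≡∅ (x , x∈p∩q⁺ (proj₁ (x∈p∩q⁻ I B x∈I∩B) , B⊆X (proj₂ (x∈p∩q⁻ I B x∈I∩B))))
    -- A dependency in I ∪ B splits as Σ(Y ∩ I) = Σ(Y ∩ B), which lies in the span of X.
    indepI∪B : LinIndep C (I ∪ B)
    indepI∪B Y Y⊆I∪B Y≢∅ Y≗0 with nonempty? (Y ∩ I)
    ... | yes Y∩I≢∅ = indepMod (Y ∩ I) (λ x∈ → proj₂ (x∈p∩q⁻ Y I x∈)) Y∩I≢∅
          (Y ∩ B , (λ x∈ → B⊆X (proj₂ (x∈p∩q⁻ Y B x∈))) , λ t → xor≡false⇒≡ (begin
            colSum C (Y ∩ I) t xor colSum C (Y ∩ B) t ≡⟨ sym (combination-⊕ (Y ∩ I) (Y ∩ B) (col C) t) ⟩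
            colSum C ((Y ∩ I) ⊕ (Y ∩ B)) t          ≡⟨ cong (λ Y′ → colSum C Y′ t) (sym (disjoint-split Y⊆I∪B I∩B≡∅)) ⟩
            colSum C Y t                            ≡⟨ Y≗0 t ⟩
            false                                   ∎))
    ... | no Y∩I≡∅ = proj₂ (proj₁ (proj₂ basis)) Y Y⊆B Y≢∅ Y≗0
      where
      Y⊆B : Y ⊆ B
      Y⊆B y∈Y with x∈p∪q⁻ I B (Y⊆I∪B y∈Y)
      ... | inj₁ y∈I = ⊥-elim (Y∩I≡∅ (_ , x∈p∩q⁺ (y∈Y , y∈I)))
      ... | inj₂ y∈B = y∈B

  contract-indep : ∀ X I → I ⊆ ⊤ ─ X → Indep (contract M X) I ⇔ IndepModulo X I
  contract-indep X I I⊆E = mk⇔ (contract-indep⇒ X I) (contract-indep⇐ X I I⊆E)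

MapsOnto : ∀ {m n} → (Fin m → Fin n) → Subset m → Subset n → Set
MapsOnto h Z Z′ = (∀ {j} → j ∈ Z → h j ∈ Z′) ×
                  (∀ {i} → i ∈ Z′ → ∃ λ j → j ∈ Z × h j ≡ i) ×
                  (∀ {j j′} → j ∈ Z → j′ ∈ Z → h j ≡ h j′ → j ≡ j′)

private
  mapsOnto-skip : ∀ {m n} {h : Fin (suc m) → Fin n} {Z Z′} →
    MapsOnto h (false ∷ Z) Z′ → MapsOnto (h ∘ suc) Z Z′
  mapsOnto-skip (into , onto , inj) =
    (λ j∈ → into (there j∈)) , onto′ , (λ a b e → suc-injective (inj (there a) (there b) e))
    where
    onto′ : ∀ {i} → i ∈ _ → ∃ λ j → j ∈ _ × _
    onto′ i∈ with onto i∈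
    ... | suc j , there j∈ , e = j , j∈ , e

  mapsOnto-remove : ∀ {m n} {h : Fin (suc m) → Fin n} {Z Z′} →
    MapsOnto h (true ∷ Z) Z′ → MapsOnto (h ∘ suc) Z (Z′ ─ ⁅ h zero ⁆)
  mapsOnto-remove {h = h} {Z} {Z′} (into , onto , inj) = into′ , onto′ ,
    (λ a b e → suc-injective (inj (there a) (there b) e))
    where
    into′ : ∀ {j} → j ∈ Z → h (suc j) ∈ Z′ ─ ⁅ h zero ⁆
    into′ j∈ = x∈p∧x∉q⇒x∈p─q (into (there j∈))
      (λ hj∈ → 0≢1+n (sym (inj (there j∈) here (x∈⁅y⁆⇒x≡y (h zero) hj∈))))
    onto′ : ∀ {i} → i ∈ Z′ ─ ⁅ h zero ⁆ → ∃ λ j → j ∈ Z × h (suc j) ≡ i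
    onto′ i∈ with onto (p─q⊆p Z′ ⁅ h zero ⁆ i∈)
    ... | zero  , _        , e = ⊥-elim (∈─⇒∉ Z′ ⁅ h zero ⁆ i∈ (subst (_∈ ⁅ h zero ⁆) e (x∈⁅x⁆ (h zero))))
    ... | suc j , there j∈ , e = j , j∈ , e

combination-reindex : ∀ {R m n} (h : Fin m → Fin n) (u : Fin m → Vector R) (w : Fin n → Vector R) Z Z′ →
  MapsOnto h Z Z′ → (∀ j → j ∈ Z → u j ≗ w (h j)) → combination Z u ≗ combination Z′ w
combination-reindex h u w [] Z′ (_ , onto , _) _ =
  λ t → sym (combination-empty Z′ w (λ (_ , i∈) → ¬Fin0 (proj₁ (onto i∈))) t)
combination-reindex h u w (false ∷ Z) Z′ bij u≗w =
  combination-reindex (h ∘ suc) (u ∘ suc) w Z Z′ (mapsOnto-skip bij) (λ j j∈ → u≗w (suc j) (there j∈))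
combination-reindex h u w (true ∷ Z) Z′ bij u≗w t = begin
  u zero t xor combination Z (u ∘ suc) t
    ≡⟨ cong₂ _xor_ (u≗w zero here t)
         (combination-reindex (h ∘ suc) (u ∘ suc) w Z (Z′ ─ ⁅ h zero ⁆) (mapsOnto-remove bij)
                              (λ j j∈ → u≗w (suc j) (there j∈)) t) ⟩
  w (h zero) t xor combination (Z′ ─ ⁅ h zero ⁆) w t
    ≡⟨ sym (combination-remove Z′ w (proj₁ bij here) t) ⟩
  combination Z′ w t ∎

preimageIn : ∀ {m n} → Subset m → (Fin m → Fin n) → Subset n → Subset m
preimageIn P h Q = tabulate (λ i → lookup P i ∧ lookup Q (h i))

∈preimageIn⁺ : ∀ {m n} {P : Subset m} {h : Fin m → Fin n} {Q i} → i ∈ P → h i ∈ Q → i ∈ preimageIn P h Q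
∈preimageIn⁺ {P = P} {h} {Q} {i} i∈P hi∈Q =
  lookup⇒∈ (trans (lookup∘tabulate _ i) (cong₂ _∧_ ([]=⇒lookup i∈P) ([]=⇒lookup hi∈Q)))

∈preimageIn⁻ : ∀ {m n} (P : Subset m) (h : Fin m → Fin n) Q {i} → i ∈ preimageIn P h Q → i ∈ P × h i ∈ Q
∈preimageIn⁻ P h Q {i} i∈ with ∧≡true⁻ (trans (sym (lookup∘tabulate _ i)) ([]=⇒lookup i∈))
... | i∈P , hi∈Q = lookup⇒∈ i∈P , lookup⇒∈ hi∈Q

module _ where
  open _≅_

  ≅-sym : ∀ {M N} → M ≅ N → N ≅ M
  ≅-sym {M} {N} φ = record
    { f = g φ ; g = f φ ; f∈ = g∈ φ ; g∈ = f∈ φ ; gf = fg φ ; fg = gf φ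
    ; ind = λ X Y X⊆ Y⊆ corr → ⇔-sym (ind φ Y X Y⊆ X⊆ (flipped X Y corr)) }
    where
    flipped : ∀ X Y → (∀ j → j ∈ E N → (j ∈ X ⇔ g φ j ∈ Y)) → ∀ i → i ∈ E M → (i ∈ Y ⇔ f φ i ∈ X)
    flipped X Y corr i i∈ = mk⇔
      (λ i∈Y → Equivalence.from (corr (f φ i) (f∈ φ i∈)) (subst (_∈ Y) (sym (gf φ i∈)) i∈Y))
      (λ fi∈X → subst (_∈ Y) (gf φ i∈) (Equivalence.to (corr (f φ i) (f∈ φ i∈)) fi∈X))

  ≅-trans : ∀ {M N P} → M ≅ N → N ≅ P → M ≅ P
  ≅-trans {M} {N} {P} φ ψ = record
    { f = λ i → f ψ (f φ i) ; g = λ k → g φ (g ψ k)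
    ; f∈ = λ i∈ → f∈ ψ (f∈ φ i∈) ; g∈ = λ k∈ → g∈ φ (g∈ ψ k∈)
    ; gf = λ i∈ → trans (cong (g φ) (gf ψ (f∈ φ i∈))) (gf φ i∈)
    ; fg = λ k∈ → trans (cong (f ψ) (fg φ (g∈ ψ k∈))) (fg ψ k∈)
    ; ind = λ X Z X⊆ Z⊆ corr → ind ψ (image X) Z (image⊆ X) Z⊆ (corr₂ X Z corr)
                                 ⇔-∘ ind φ X (image X) X⊆ (image⊆ X) (corr₁ X) }
    where
    image : Subset (size M) → Subset (size N)
    image X = preimageIn (E N) (g φ) X
    image⊆ : ∀ X → image X ⊆ E N
    image⊆ X j∈ = proj₁ (∈preimageIn⁻ (E N) (g φ) X j∈)
    corr₁ : ∀ X → ∀ i → i ∈ E M → (i ∈ X ⇔ f φ i ∈ image X)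
    corr₁ X i i∈ = mk⇔ (λ i∈X → ∈preimageIn⁺ (f∈ φ i∈) (subst (_∈ X) (sym (gf φ i∈)) i∈X))
                        (λ fi∈ → subst (_∈ X) (gf φ i∈) (proj₂ (∈preimageIn⁻ (E N) (g φ) X fi∈)))
    corr₂ : ∀ X Z → (∀ i → i ∈ E M → (i ∈ X ⇔ f ψ (f φ i) ∈ Z)) →
            ∀ j → j ∈ E N → (j ∈ image X ⇔ f ψ j ∈ Z)
    corr₂ X Z corr j j∈ = mk⇔
      (λ j∈X → subst (λ k → f ψ k ∈ Z) (fg φ j∈) (Equivalence.to (corr (g φ j) (g∈ φ j∈))
                                                     (proj₂ (∈preimageIn⁻ (E N) (g φ) X j∈X))))
      (λ fj∈ → ∈preimageIn⁺ j∈ (Equivalence.from (corr (g φ j) (g∈ φ j∈)) (subst (λ k → f ψ k ∈ Z) (sym (fg φ j∈)) fj∈)))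

  delete-⊥ : ∀ M → delete M ⊥ ≅ M
  delete-⊥ M = record
    { f = λ i → i ; g = λ i → i ; f∈ = p─q⊆p (E M) ⊥ ; g∈ = λ i∈ → x∈p∧x∉q⇒x∈p─q i∈ ∉⊥
    ; gf = λ _ → refl ; fg = λ _ → refl
    ; ind = λ X Y X⊆ Y⊆ corr → let X≡Y = ⊆-antisym (λ i∈ → Equivalence.to (corr _ (X⊆ i∈)) i∈)
                                                  (λ i∈ → Equivalence.from (corr _ (x∈p∧x∉q⇒x∈p─q (Y⊆ i∈) ∉⊥)) i∈)
                               in mk⇔ (λ (_ , indX) → Y⊆ , subst (Ind M) X≡Y indX)
                                      (λ (_ , indY) → X⊆ , subst (Ind M) (sym X≡Y) indY) }

record Bijection {m n} (E₁ : Subset m) (E₂ : Subset n) : Set where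
  field
    to      : Fin m → Fin n
    from    : Fin n → Fin m
    to∈     : ∀ {i} → i ∈ E₁ → to i ∈ E₂
    from∈   : ∀ {j} → j ∈ E₂ → from j ∈ E₁
    from∘to : ∀ {i} → i ∈ E₁ → from (to i) ≡ i
    to∘from : ∀ {j} → j ∈ E₂ → to (from j) ≡ j

module Transport {m n} {E₁ : Subset m} {E₂ : Subset n} (β : Bijection E₁ E₂) where
  open Bijection β

  Corresponds : Subset m → Subset n → Set
  Corresponds X Y = ∀ i → i ∈ E₁ → (i ∈ X ⇔ to i ∈ Y)

  forward : ∀ {X Y} → X ⊆ E₁ → Y ⊆ E₂ → Corresponds X Y →
            ∀ Z → Z ⊆ X → Nonempty Z → ∃ λ Z′ → Z′ ⊆ Y × Nonempty Z′ × MapsOnto to Z Z′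
  forward {X} {Y} X⊆ Y⊆ corr Z Z⊆X (j , j∈Z) =
    Z′ , (λ i∈ → proj₁ (∈preimageIn⁻ Y from Z i∈)) , (to j , into j∈Z) , into , onto , injective
    where
    Z′ = preimageIn Y from Z
    into : ∀ {j} → j ∈ Z → to j ∈ Z′
    into j∈ = ∈preimageIn⁺ (Equivalence.to (corr _ (X⊆ (Z⊆X j∈))) (Z⊆X j∈))
                           (subst (_∈ Z) (sym (from∘to (X⊆ (Z⊆X j∈)))) j∈)
    onto : ∀ {i} → i ∈ Z′ → ∃ λ j → j ∈ Z × to j ≡ i
    onto i∈ with ∈preimageIn⁻ Y from Z i∈
    ... | i∈Y , fi∈Z = _ , fi∈Z , to∘from (Y⊆ i∈Y)
    injective : ∀ {j j′} → j ∈ Z → j′ ∈ Z → to j ≡ to j′ → j ≡ j′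
    injective a b e = trans (sym (from∘to (X⊆ (Z⊆X a)))) (trans (cong from e) (from∘to (X⊆ (Z⊆X b))))

  backward : ∀ {X Y} → X ⊆ E₁ → Y ⊆ E₂ → Corresponds X Y →
             ∀ Z′ → Z′ ⊆ Y → Nonempty Z′ → ∃ λ Z → Z ⊆ X × Nonempty Z × MapsOnto to Z Z′
  backward {X} {Y} X⊆ Y⊆ corr Z′ Z′⊆Y (i , i∈Z′) =
    Z , (λ j∈ → proj₁ (∈preimageIn⁻ X to Z′ j∈)) , (from i , proj₁ (proj₂ (onto i∈Z′))) ,
    (λ j∈ → proj₂ (∈preimageIn⁻ X to Z′ j∈)) , onto , injective
    where
    Z = preimageIn X to Z′
    onto : ∀ {i} → i ∈ Z′ → ∃ λ j → j ∈ Z × to j ≡ i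
    onto {i} i∈ = from i ,
      ∈preimageIn⁺ (Equivalence.from (corr _ (from∈ (Y⊆ (Z′⊆Y i∈))))
                                      (subst (_∈ Y) (sym (to∘from (Y⊆ (Z′⊆Y i∈)))) (Z′⊆Y i∈)))
                   (subst (_∈ Z′) (sym (to∘from (Y⊆ (Z′⊆Y i∈)))) i∈) ,
      to∘from (Y⊆ (Z′⊆Y i∈))
    injective : ∀ {j j′} → j ∈ Z → j′ ∈ Z → to j ≡ to j′ → j ≡ j′
    injective a b e = trans (sym (from∘to (X⊆ (proj₁ (∈preimageIn⁻ X to Z′ a)))))
                     (trans (cong from e) (from∘to (X⊆ (proj₁ (∈preimageIn⁻ X to Z′ b)))))

  transport-free : ∀ (P : Subset m → Set) (P′ : Subset n → Set) →
    (∀ Z Z′ → Z ⊆ E₁ → MapsOnto to Z Z′ → (P Z ⇔ P′ Z′)) →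
    ∀ {X Y} → X ⊆ E₁ → Y ⊆ E₂ → Corresponds X Y → Free P X ⇔ Free P′ Y
  transport-free P P′ P⇔P′ {X} {Y} X⊆ Y⊆ corr = mk⇔ free→ free←
    where
    free→ : Free P X → Free P′ Y
    free→ freeX Z′ Z′⊆Y Z′≢∅ P′Z′ with backward X⊆ Y⊆ corr Z′ Z′⊆Y Z′≢∅
    ... | Z , Z⊆X , Z≢∅ , bij = freeX Z Z⊆X Z≢∅ (Equivalence.from (P⇔P′ Z Z′ (X⊆ ∘ Z⊆X) bij) P′Z′)
    free← : Free P′ Y → Free P X
    free← freeY Z Z⊆X Z≢∅ PZ with forward X⊆ Y⊆ corr Z Z⊆X Z≢∅
    ... | Z′ , Z′⊆Y , Z′≢∅ , bij = freeY Z′ Z′⊆Y Z′≢∅ (Equivalence.to (P⇔P′ Z Z′ (X⊆ ∘ Z⊆X) bij) PZ)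

iso : ∀ {M N} (β : Bijection (E M) (E N)) →
      (∀ X Y → X ⊆ E M → Y ⊆ E N → Transport.Corresponds β X Y → Indep M X ⇔ Indep N Y) → M ≅ N
iso β ind = record { f = to ; g = from ; f∈ = to∈ ; g∈ = from∈ ; gf = from∘to ; fg = to∘from ; ind = ind }
  where open Bijection β

≗-replaceˡ : ∀ {R} {u u′ : Vector R} → u ≗ u′ → ∀ w → (u ≗ w ⇔ u′ ≗ w)
≗-replaceˡ u≗u′ w = mk⇔ (λ u≗w t → trans (sym (u≗u′ t)) (u≗w t)) (λ u′≗w t → trans (u≗u′ t) (u′≗w t))

-- Let A_T = addRow A T and M_T / T′ ≅ P, where P has full ground
-- set.  Take the columns e₀ (for the new element a = 0) and the A_T-columns of P's
-- elements (for suc j), and project away the span of T′.  The result N satisfies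
-- N \ a ≅ M_T / T′, and N / a ≅ M / T′ because contracting a also kills e₀, that is,
-- the row added to A.
module SplittingExtension {r n} (A : Matrix r n) (T T′ : Subset n) {P : Matroid}
  (φ : contract (splitting A T) T′ ≅ P) (P-full : ∀ j → j ∈ E P) (z : Fin (size P)) where

  open _≅_ φ using (f; g; g∈; gf; fg)

  Aₜ : Matrix (suc r) n
  Aₜ = addRow A T

  column : Fin (suc (size P)) → Vector (suc r)
  column zero    = e₀
  column (suc j) = col Aₜ (g j)

  open Quotient Aₜ T′

  N : Matrix (2 ^ suc r) (suc (size P))
  N = projectMatrix column

  -- The element of M represented by each non-new element of N (zero is a dummy value).
  element : Fin (suc (size P)) → Fin n
  element zero    = g z
  element (suc j) = g j

  E₁ : Subset (suc (size P))
  E₁ = ⊤ ─ ⁅ zero ⁆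

  0∉E₁ : zero ∉ E₁
  0∉E₁ 0∈ = ∈─⇒∉ ⊤ ⁅ zero ⁆ 0∈ (x∈⁅x⁆ zero)

  β : Bijection E₁ (⊤ ─ T′)
  β = record
    { to = element ; from = suc ∘ f
    ; to∈ = λ { {zero} 0∈ → ⊥-elim (0∉E₁ 0∈) ; {suc j} _ → g∈ (P-full j) }
    ; from∈ = λ _ → x∈p∧x∉q⇒x∈p─q ∈⊤ (λ 1+j∈ → 0≢1+n (sym (x∈⁅y⁆⇒x≡y zero 1+j∈)))
    ; from∘to = λ { {zero} 0∈ → ⊥-elim (0∉E₁ 0∈) ; {suc j} _ → cong suc (fg (P-full j)) }
    ; to∘from = gf }

  open Transport β using (transport-free)

  colSum-N : ∀ Z Z′ → Z ⊆ E₁ → MapsOnto element Z Z′ → colSum N Z ≗ project (colSum Aₜ Z′)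
  colSum-N Z Z′ Z⊆E₁ bij i =
    trans (colSum-projectMatrix column Z i)
          (project-cong (combination-reindex element column (col Aₜ) Z Z′ bij agree) i)
    where
    agree : ∀ j → j ∈ Z → column j ≗ col Aₜ (element j)
    agree zero    0∈Z = ⊥-elim (0∉E₁ (Z⊆E₁ 0∈Z))
    agree (suc j) _   = λ t → refl

  dependent⇔ : ∀ Z Z′ → Z ⊆ E₁ → MapsOnto element Z Z′ →
               colSum N Z ≗ 0ᵛ ⇔ InSpan Aₜ T′ (colSum Aₜ Z′)
  dependent⇔ Z Z′ Z⊆E₁ bij = kernel (colSum Aₜ Z′) ⇔-∘ ≗-replaceˡ (colSum-N Z Z′ Z⊆E₁ bij) 0ᵛ

  -- Sets spanned by a in N are sets spanned by T′ in A:
  --   Σ_N Z ∈ ⟨a⟩  ⇔  p(Σ_{A_T} Z′) ∈ {0, p(e₀)}  ⇔  Σ_{A_T} Z′ or Σ_{A_T} Z′ + e₀ lies in ⟨T′⟩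
  --                ⇔  Σ_A Z′ ∈ ⟨T′⟩.
  spannedByA⇔ : ∀ Z Z′ → Z ⊆ E₁ → MapsOnto element Z Z′ →
                InSpan N ⁅ zero ⁆ (colSum N Z) ⇔ InSpan A T′ (colSum A Z′)
  spannedByA⇔ Z Z′ Z⊆E₁ bij =
    ⇔-sym (inSpan-addRow A T T′ (colSum Aₜ Z′)) ⇔-∘
    ((kernel (colSum Aₜ Z′) ⊎-⇔ project-≗ (colSum Aₜ Z′) e₀) ⇔-∘
    ((≗-replaceˡ ΣN≗ 0ᵛ ⊎-⇔ ≗-replaceˡ ΣN≗ (project e₀)) ⇔-∘
    inSpan-⁅⁆ N zero (colSum N Z)))
    where
    ΣN≗ = colSum-N Z Z′ Z⊆E₁ bij

  deletion-indep : ∀ X → X ⊆ E₁ → Indep (vecMatroid N ＼ zero) X ⇔ LinIndep N X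
  deletion-indep X X⊆E₁ = mk⇔ proj₂ (λ indep → (λ {x} → X⊆E₁ {x}) , indep)

  N＼a≅M_T/T′ : vecMatroid N ＼ zero ≅ contract (vecMatroid Aₜ) T′
  N＼a≅M_T/T′ = iso β λ X Y X⊆ Y⊆ corr →
    ⇔-sym (VectorMatroid.contract-indep Aₜ T′ Y Y⊆) ⇔-∘
    (transport-free _ _ dependent⇔ X⊆ Y⊆ corr ⇔-∘ deletion-indep X X⊆)

  N／a≅M/T′ : vecMatroid N ／ zero ≅ contract (vecMatroid A) T′
  N／a≅M/T′ = iso β λ X Y X⊆ Y⊆ corr →
    ⇔-sym (VectorMatroid.contract-indep A T′ Y Y⊆) ⇔-∘
    (transport-free _ _ spannedByA⇔ X⊆ Y⊆ corr ⇔-∘ VectorMatroid.contract-indep N ⁅ zero ⁆ X X⊆)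

splitting-extension : ∀ {r n} (A : Matrix r n) (T T′ : Subset n) {P : Matroid} →
  contract (splitting A T) T′ ≅ P → (∀ j → j ∈ E P) → Fin (size P) →
  ∃[ r′ ] ∃[ n′ ] Σ (Matrix r′ n′) λ B → Σ (Fin n′) λ a →
    (vecMatroid B ＼ a ≅ P) × (vecMatroid B ／ a ≅ contract (vecMatroid A) T′)
splitting-extension A T T′ φ P-full z =
  _ , _ , N , zero , ≅-trans N＼a≅M_T/T′ φ , N／a≅M/T′
  where open SplittingExtension A T T′ φ P-full z

contraction-minor : ∀ {P} M X → X ⊆ E M → contract M X ≅ P → IsMinor P M
contraction-minor M X X⊆E M/X≅P =
  X , ⊥ , X⊆E , (λ x∈⊥ → ⊥-elim (∉⊥ x∈⊥)) , (λ (_ , x∈X∩⊥) → ∉⊥ (proj₂ (x∈p∩q⁻ X ⊥ x∈X∩⊥))) ,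
  ≅-trans (delete-⊥ (contract M X)) M/X≅P

excluded-full : ∀ {F} → Excluded F → ∀ j → j ∈ E F
excluded-full isF₇    _ = ∈⊤
excluded-full isF₇*   _ = ∈⊤
excluded-full isM*K₅  _ = ∈⊤
excluded-full isM*K₃₃ _ = ∈⊤

excluded-element : ∀ {F} → Excluded F → Fin (size F)
excluded-element isF₇    = zero
excluded-element isF₇*   = zero
excluded-element isM*K₅  = zero
excluded-element isM*K₃₃ = zero

-- Lemma 6.2.
lemma6p2 : (k : ℕ) → 4 ≤ k →
    ∀ {r n} (A : Matrix r n) →
    IsGraphic (vecMatroid A) →
    (∀ e → ¬ Coloop (vecMatroid A) e) →
    (∀ C → Cocircuit (vecMatroid A) C → ∣ C ∣ ≢ 2) →
    (T T' : Subset n) → ∣ T ∣ ≡ k → T' ⊆ T →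
    (F : Matroid) → Excluded F →
    contract (splitting A T) T' ≅ F →
    ∃[ r' ] ∃[ n' ] Σ (Matrix r' n') λ B → Σ (Fin n') λ a →
      (vecMatroid B ＼ a ≅ F) ×
      IsMinor (vecMatroid B ／ a) (vecMatroid A) ×
      ((vecMatroid A ≅ vecMatroid B ／ a) ⊎
       (∃[ h ] (h ≤ k × CoextensionBy (vecMatroid A) (vecMatroid B ／ a) h)))
lemma6p2 k _ A _ _ _ T T′ ∣T∣≡k T′⊆T F excluded M_T/T′≅F =
  let (r′ , n′ , B , a , N＼a≅F , N／a≅M/T′) =
        splitting-extension A T T′ M_T/T′≅F (excluded-full excluded) (excluded-element excluded)
      M/T′≅N／a = ≅-sym N／a≅M/T′
  in r′ , n′ , B , a , N＼a≅F ,
     contraction-minor (vecMatroid A) T′ (λ _ → ∈⊤) M/T′≅N／a ,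
     inj₂ (∣ T′ ∣ , subst (∣ T′ ∣ ≤_) ∣T∣≡k (p⊆q⇒∣p∣≤∣q∣ T′⊆T) , T′ , (λ _ → ∈⊤) , refl , M/T′≅N／a)
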